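{- Let $V$ be an $m\times n$ $(0,1)$-matrix and $B$ a $p\times q$ $(0,1)$-matrix, let $L=\begin{bmatrix}0 & V\\ V^T & 0\end{bmatrix}$, $H=\begin{bmatrix}0 & B\\ B^T & 0\end{bmatrix}$, $H^{\#}=\begin{bmatrix}0 & B^T\\ B & 0\end{bmatrix}$, and suppose the bipartite graphs $G_L$ and $G_H$ (not necessarily connected) have no isolated vertices. Then the following are equivalent: (a) there exists an isomorphism between $G_{L\underline{\otimes}H}$ and $G_{L\underline{\otimes}H^{\#}}$ which respects the partite sets of the canonical bipartitions; (b) at least one of $G_L$ (with respect to $V$) or $G_H$ (with respect to $B$) has property $\pi$, i.e. $V$ is PET or $B$ is PET.
   Context: For a symmetric $(0,1)$-matrix $A$ with zero diagonal, $G_A$ is the simple graph with adjacency matrix $A$; so $G_L$ (resp. $G_H$) is the bipartite graph with biadjacency matrix $V$ (resp. $B$). The partitioned tensor product of $2\times 2$ block matrices is $\begin{bmatrix}U & V'\\ W & X\end{bmatrix}\underline{\otimes}\begin{bmatrix}A & B'\\ C & D\end{bmatrix}=\begin{bmatrix}U\otimes A & V'\otimes B'\\ W\otimes C & X\otimes D\end{bmatrix}$ ($\otimes$ the Kronecker product), so $L\underline{\otimes}H=\begin{bmatrix}0 & V\otimes B\\ V^T\otimes B^T & 0\end{bmatrix}$ and $L\underline{\otimes}H^{\#}=\begin{bmatrix}0 & V\otimes B^T\\ V^T\otimes B & 0\end{bmatrix}$. The canonical bipartition of $G_{L\underline{\otimes}H}$ is $X_1\cup Y_1$, where $X_1$ is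 the set of the first $mp$ vertices (rows of $V\otimes B$) and $Y_1$ the last $nq$ vertices (columns of $V\otimes B$); the canonical bipartition of $G_{L\underline{\otimes}H^{\#}}$ is $X_2\cup Y_2$ with $X_2$ the first $mq$ vertices (rows of $V\otimes B^T$) and $Y_2$ the last $np$ vertices. An isomorphism $f$ respects these partite sets if either $f(X_1)=X_2$ and $f(Y_1)=Y_2$, or $f(X_1)=Y_2$ and $f(Y_1)=X_2$. A square matrix $M$ is PET if it is permutationally equivalent to its transpose, i.e. $PMQ=M^T$ for some permutation matrices $P,Q$. A bipartite graph with biadjacency matrix $M$ has property $\pi$ with respect to $M$ if $M$ is PET. -}

module Defs where

open import Data.Nat using (ℕ)
open import Data.Fin using (Fin)
open import Data.Bool using (Bool; true; false; not; _∧_)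
open import Data.Product using (_×_; _,_; ∃; Σ)
open import Data.Sum using (_⊎_; inj₁; inj₂)
open import Function.Bundles using (_↔_; Inverse)
open import Data.Fin.Permutation using (Permutation; _⟨$⟩ʳ_)
open import Relation.Binary.PropositionalEquality using (_≡_)

Mat : Set → Set → Set
Mat I J = I → J → Bool

zeroM : ∀ {I J : Set} → Mat I J
zeroM _ _ = false

transpose : ∀ {I J : Set} → Mat I J → Mat J I
transpose M j i = M i j

_⊗_ : ∀ {I J K L : Set} → Mat I J → Mat K L → Mat (I × K) (J × L)
(V ⊗ B) (i , k) (j , l) = V i j ∧ B k l

record Block (I J : Set) : Set where
  constructor block
  field
    U  : Mat I I
    V' : Mat I J
    W  : Mat J I
    X  : Mat J J

toMat : ∀ {I J : Set} → Block I J → Mat (I ⊎ J) (I ⊎ J)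
toMat b (inj₁ i) (inj₁ i') = Block.U b i i'
toMat b (inj₁ i) (inj₂ j)  = Block.V' b i j
toMat b (inj₂ j) (inj₁ i)  = Block.W b j i
toMat b (inj₂ j) (inj₂ j') = Block.X b j j'

_⊗̲_ : ∀ {I J K L : Set} → Block I J → Block K L → Block (I × K) (J × L)
b ⊗̲ c = block (Block.U b ⊗ Block.U c) (Block.V' b ⊗ Block.V' c)
              (Block.W b ⊗ Block.W c) (Block.X b ⊗ Block.X c)

bip : ∀ {I J : Set} → Mat I J → Block I J
bip M = block zeroM M (transpose M) zeroM

bipSharp : ∀ {I J : Set} → Mat I J → Block J I
bipSharp M = block zeroM (transpose M) M zeroM

NoIsolated : ∀ {I : Set} → Mat I I → Set
NoIsolated A = ∀ u → ∃ λ v → A u v ≡ true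

side : ∀ {I J : Set} → I ⊎ J → Bool
side (inj₁ _) = true
side (inj₂ _) = false

IsGraphIso : ∀ {I I' : Set} → Mat I I → Mat I' I' → I ↔ I' → Set
IsGraphIso A A' f = ∀ u v → A u v ≡ A' (Inverse.to f u) (Inverse.to f v)

RespectsParts : ∀ {I J I' J' : Set} → (I ⊎ J) ↔ (I' ⊎ J') → Set
RespectsParts f = (∀ v → side (Inverse.to f v) ≡ side v)
                ⊎ (∀ v → side (Inverse.to f v) ≡ not (side v))

IsoRespecting : ∀ {I J I' J' : Set} → Block I J → Block I' J' → Set
IsoRespecting b c = Σ ((_ ⊎ _) ↔ (_ ⊎ _)) λ f →
  IsGraphIso (toMat b) (toMat c) f × RespectsParts f

-- PET: P M Q = Mᵀ for permutation matrices P, Q.  For an m×n matrix M,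
-- (P M Q) j i = M (σ j) (τ i) with σ : Fin n ↔ Fin m, τ : Fin m ↔ Fin n
-- (such bijections exist only when m = n, i.e. M is square).
PET : ∀ {m n : ℕ} → Mat (Fin m) (Fin n) → Set
PET {m} {n} M = Σ (Permutation n m) λ σ → Σ (Permutation m n) λ τ →
  ∀ (j : Fin n) (i : Fin m) → M (σ ⟨$⟩ʳ j) (τ ⟨$⟩ʳ i) ≡ transpose M j i

-- A bipartition-respecting isomorphism either keeps the sides, and then is a pair of row and column
-- bijections exhibiting V ⊗ B ≃ V ⊗ Bᵀ, or swaps them, and then exhibits V ⊗ B ≃ Vᵀ ⊗ B.
-- A factor A with at least one 1 can be cancelled from A ⊗ M ≃ A ⊗ N (as in Lovász's cancellation
-- for direct products): count the placements of a pattern of a left and b right vertices subject to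
-- a conjunction of atoms "two placed vertices coincide" and "a placed left vertex is adjacent to a
-- placed right vertex". These counts multiply over ⊗, are positive for A (place everything on one
-- edge) and are isomorphism invariant, so M and N have the same counts; by inclusion–exclusion also
-- for conjunctions of literals. Hence the complete literal profile of the identity placement of M is
-- realised in N, which is an embedding M ≲ N. For N = Mᵀ it consists of injections between the row
-- and column sets in both directions, i.e. of bijections, so M is PET. A factor without a 1 has no
-- vertices at all, hence is PET trivially. Conversely PET V (PET B) gives V ⊗ B ≃ Vᵀ ⊗ B (≃ V ⊗ Bᵀ).

module Submission where

open import Defs
open import Algebra.Bundles using (CommutativeMonoid)
open import Data.Bool using (Bool; true; false; not; _∧_; T)
open import Data.Bool.ListAction using (all; and)
open import Data.Bool.Properties using (not-involutive; ∧-comm; ∧-commutativeMonoid; T-∧; T-≡)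
open import Data.Fin using (Fin; zero; suc; punchIn; punchOut)
import Data.Fin.Permutation as Perm
import Data.Fin.Properties as Fin
open import Data.List using (List; []; _∷_; _++_; cartesianProductWith)
import Data.List as List
import Data.List.Properties as List
open import Data.List.Membership.Propositional using (_∈_)
open import Data.List.Membership.Propositional.Properties
  using (∈-++⁺ˡ; ∈-++⁺ʳ; ∈-cartesianProductWith⁺; ∈-allFin)
import Data.List.Relation.Unary.All as All
open import Data.List.Relation.Unary.All.Properties using (all⁺; all⁻; map⁺; map⁻)
open import Data.Nat using (ℕ; zero; suc; _+_; _*_; _≤_; >-nonZero)
open import Data.Nat.Properties
  using (+-*-semiring; *-comm; *-cancelˡ-≡; +-cancelʳ-≡; +-identityʳ; m≤m+n; ≤-refl; ≤-reflexive; ≤-trans; <⇒≱; m<n⇒n≢0)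
import Data.Nat.Properties as ℕ
open import Data.Product using (_×_; _,_; proj₁; proj₂; Σ; ∃; ∃₂; uncurry)
open import Data.Product.Algebra using (×-comm)
open import Data.Product.Function.NonDependent.Propositional using (_×-↔_)
open import Data.Product.Properties using (,-injective)
open import Data.Sum using (_⊎_; inj₁; inj₂; swap)
open import Data.Sum.Algebra using (⊎-comm)
open import Data.Sum.Function.Propositional using (_⊎-↔_)
open import Data.Sum.Properties using (inj₁-injective; swap-involutive)
open import Data.Vec using (Vec; []; _∷_; lookup; replicate; zip; unzip; allFin)
import Data.Vec as Vec
open import Data.Vec.Properties
  using (∷-injectiveˡ; ∷-injectiveʳ; lookup-zip; lookup-map; lookup-replicate; lookup-allFin; zip∘unzip; unzip∘zip)
import Data.Vec.Properties as Vec
open import Function using (_∘_)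
open import Function.Bundles using (_↔_; Inverse; mk↔ₛ′; _↣_; Injection; mk↣; mk⇔; Equivalence)
open import Function.Construct.Composition using (_↔-∘_)
open import Function.Construct.Identity using (↔-id)
open import Function.Definitions using (Injective)
open import Function.Properties.Inverse using (↔⇒↣)
open import Relation.Binary.Definitions using (DecidableEquality)
open import Relation.Binary.PropositionalEquality
open import Relation.Nullary using (¬_; Dec; yes; no; does; contradiction)
open import Relation.Nullary.Decidable using (map′; _×-dec_; does-⇔; dec-true)
open import Algebra.Properties.CommutativeSemigroup (CommutativeMonoid.commutativeSemigroup ∧-commutativeMonoid)
  using (interchange)
open import Algebra.Properties.Semiring.Sum +-*-semiring
  using (sum; sum-remove; sum-cong-≗; ∑-distrib-+; *-distribˡ-sum; sum-replicate-zero)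

-- Finite types and sums over them

data U : Set where
  fin : ℕ → U
  _⊠_ : U → U → U
  vec : U → ℕ → U

El : U → Set
El (fin n) = Fin n
El (A ⊠ B) = El A × El B
El (vec A n) = Vec (El A) n

decEq : (A : U) → DecidableEquality (El A)
decEq (fin n) = Fin._≟_
decEq (A ⊠ B) (x , y) (x′ , y′) =
  map′ (uncurry (cong₂ _,_)) ,-injective (decEq A x x′ ×-dec decEq B y y′)
decEq (vec A n) = Vec.≡-dec (decEq A)

does-decEq-↔ : ∀ A B (e : El A ↔ El B) x y →
  does (decEq B (Inverse.to e x) (Inverse.to e y)) ≡ does (decEq A x y)
does-decEq-↔ A B e x y = does-⇔ (mk⇔ (Injection.injective (↔⇒↣ e)) (cong (Inverse.to e)))
  (decEq B (Inverse.to e x) (Inverse.to e y)) (decEq A x y)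

sumU : (A : U) → (El A → ℕ) → ℕ
sumU (fin n) f = sum f
sumU (A ⊠ B) f = sumU A λ x → sumU B λ y → f (x , y)
sumU (vec A zero) f = f []
sumU (vec A (suc n)) f = sumU A λ x → sumU (vec A n) λ xs → f (x ∷ xs)

sumU-cong : ∀ A {f g : El A → ℕ} → (∀ x → f x ≡ g x) → sumU A f ≡ sumU A g
sumU-cong (fin n) f≗g = sum-cong-≗ f≗g
sumU-cong (A ⊠ B) f≗g = sumU-cong A λ x → sumU-cong B λ y → f≗g (x , y)
sumU-cong (vec A zero) f≗g = f≗g []
sumU-cong (vec A (suc n)) f≗g = sumU-cong A λ x → sumU-cong (vec A n) λ xs → f≗g (x ∷ xs)

sumU-0 : ∀ A {f : El A → ℕ} → (∀ x → f x ≡ 0) → sumU A f ≡ 0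
sumU-0 (fin n) f≗0 = trans (sum-cong-≗ f≗0) (sum-replicate-zero n)
sumU-0 (A ⊠ B) f≗0 = sumU-0 A λ x → sumU-0 B λ y → f≗0 (x , y)
sumU-0 (vec A zero) f≗0 = f≗0 []
sumU-0 (vec A (suc n)) f≗0 = sumU-0 A λ x → sumU-0 (vec A n) λ xs → f≗0 (x ∷ xs)

sumU-+ : ∀ A (f g : El A → ℕ) → sumU A (λ x → f x + g x) ≡ sumU A f + sumU A g
sumU-+ (fin n) f g = ∑-distrib-+ f g
sumU-+ (A ⊠ B) f g =
  trans (sumU-cong A λ x → sumU-+ B (λ y → f (x , y)) (λ y → g (x , y))) (sumU-+ A _ _)
sumU-+ (vec A zero) f g = refl
sumU-+ (vec A (suc n)) f g =
  trans (sumU-cong A λ x → sumU-+ (vec A n) (λ xs → f (x ∷ xs)) (λ xs → g (x ∷ xs))) (sumU-+ A _ _)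

sumU-*ˡ : ∀ A c (f : El A → ℕ) → sumU A (λ x → c * f x) ≡ c * sumU A f
sumU-*ˡ (fin n) c f = sym (*-distribˡ-sum c f)
sumU-*ˡ (A ⊠ B) c f = trans (sumU-cong A λ x → sumU-*ˡ B c _) (sumU-*ˡ A c _)
sumU-*ˡ (vec A zero) c f = refl
sumU-*ˡ (vec A (suc n)) c f = trans (sumU-cong A λ x → sumU-*ˡ (vec A n) c _) (sumU-*ˡ A c _)

sumU-⊠-* : ∀ A B (f : El A → ℕ) (g : El B → ℕ) →
  sumU (A ⊠ B) (λ (x , y) → f x * g y) ≡ sumU A f * sumU B g
sumU-⊠-* A B f g = begin
  sumU A (λ x → sumU B λ y → f x * g y)  ≡⟨ sumU-cong A (λ x → sumU-*ˡ B (f x) g) ⟩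
  sumU A (λ x → f x * sumU B g)          ≡⟨ sumU-cong A (λ x → *-comm (f x) _) ⟩
  sumU A (λ x → sumU B g * f x)          ≡⟨ sumU-*ˡ A (sumU B g) f ⟩
  sumU B g * sumU A f                    ≡⟨ *-comm (sumU B g) _ ⟩
  sumU A f * sumU B g                    ∎
  where open ≡-Reasoning

sumU-comm : ∀ A B (f : El A → El B → ℕ) →
  sumU A (λ x → sumU B (f x)) ≡ sumU B (λ y → sumU A λ x → f x y)
sumU-comm (fin zero) B f = sym (sumU-0 B λ _ → refl)
sumU-comm (fin (suc n)) B f =
  trans (cong (sumU B (f zero) +_) (sumU-comm (fin n) B (f ∘ suc))) (sym (sumU-+ B (f zero) _))
sumU-comm (A ⊠ A′) B f =
  trans (sumU-cong A λ x → sumU-comm A′ B λ x′ → f (x , x′)) (sumU-comm A B _)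
sumU-comm (vec A zero) B f = refl
sumU-comm (vec A (suc n)) B f =
  trans (sumU-cong A λ x → sumU-comm (vec A n) B λ xs → f (x ∷ xs)) (sumU-comm A B _)

sumU-single : ∀ A (x₀ : El A) {f : El A → ℕ} → (∀ x → x ≢ x₀ → f x ≡ 0) → sumU A f ≡ f x₀
sumU-single (fin (suc n)) x₀ {f} vanish =
  trans (sum-remove f)
        (trans (cong (f x₀ +_) (sumU-0 (fin n) λ j → vanish (punchIn x₀ j) (Fin.punchInᵢ≢i x₀ j)))
               (+-identityʳ (f x₀)))
sumU-single (A ⊠ B) (x₀ , y₀) vanish =
  trans (sumU-single A x₀ λ x x≢x₀ → sumU-0 B λ y → vanish (x , y) (x≢x₀ ∘ cong proj₁))
        (sumU-single B y₀ λ y y≢y₀ → vanish (x₀ , y) (y≢y₀ ∘ cong proj₂))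
sumU-single (vec A zero) [] vanish = refl
sumU-single (vec A (suc n)) (x₀ ∷ xs₀) vanish =
  trans (sumU-single A x₀ λ x x≢x₀ → sumU-0 (vec A n) λ xs → vanish (x ∷ xs) (x≢x₀ ∘ ∷-injectiveˡ))
        (sumU-single (vec A n) xs₀ λ xs xs≢xs₀ → vanish (x₀ ∷ xs) (xs≢xs₀ ∘ ∷-injectiveʳ))

≤-sumU : ∀ A (f : El A → ℕ) x → f x ≤ sumU A f
≤-sumU (fin (suc n)) f x = ≤-trans (m≤m+n (f x) _) (≤-reflexive (sym (sum-remove f)))
≤-sumU (A ⊠ B) f (x , y) = ≤-trans (≤-sumU B _ y) (≤-sumU A _ x)
≤-sumU (vec A zero) f [] = ≤-refl
≤-sumU (vec A (suc n)) f (x ∷ xs) = ≤-trans (≤-sumU (vec A n) _ xs) (≤-sumU A _ x)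

sum-nonzero : ∀ n (f : Fin n → ℕ) → sum f ≢ 0 → ∃ λ i → f i ≢ 0
sum-nonzero zero f s≢0 = contradiction refl s≢0
sum-nonzero (suc n) f s≢0 with f zero ℕ.≟ 0
... | no f₀≢0 = zero , f₀≢0
... | yes f₀≡0 =
  let i , fᵢ₊₁≢0 = sum-nonzero n (f ∘ suc) λ s≡0 → s≢0 (cong₂ _+_ f₀≡0 s≡0)
  in suc i , fᵢ₊₁≢0

sumU-nonzero : ∀ A (f : El A → ℕ) → sumU A f ≢ 0 → ∃ λ x → f x ≢ 0
sumU-nonzero (fin n) f s≢0 = sum-nonzero n f s≢0
sumU-nonzero (A ⊠ B) f s≢0 =
  let x , inner≢0 = sumU-nonzero A _ s≢0
      y , fxy≢0 = sumU-nonzero B _ inner≢0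
  in (x , y) , fxy≢0
sumU-nonzero (vec A zero) f s≢0 = [] , s≢0
sumU-nonzero (vec A (suc n)) f s≢0 =
  let x , inner≢0 = sumU-nonzero A _ s≢0
      xs , fxxs≢0 = sumU-nonzero (vec A n) _ inner≢0
  in (x ∷ xs) , fxxs≢0

ind : Bool → ℕ
ind true = 1
ind false = 0

ind-yes : ∀ {P : Set} (p? : Dec P) n → P → ind (does p?) * n ≡ n
ind-yes (yes _) n _ = +-identityʳ n
ind-yes (no ¬p) n p = contradiction p ¬p

ind-no : ∀ {P : Set} (p? : Dec P) n → ¬ P → ind (does p?) * n ≡ 0
ind-no (yes p) n ¬p = contradiction p ¬p
ind-no (no _) n _ = refl

ind-∧ : ∀ x y → ind (x ∧ y) ≡ ind x * ind y
ind-∧ true y = sym (+-identityʳ (ind y))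
ind-∧ false y = refl

T⇒ind≡1 : ∀ {b} → T b → ind b ≡ 1
T⇒ind≡1 {true} _ = refl

ind≢0⇒T : ∀ b → ind b ≢ 0 → T b
ind≢0⇒T true _ = _
ind≢0⇒T false ind≢0 = contradiction refl ind≢0

-- Both sides equal the sum of g b over the pairs (a , b) with to a ≡ b.
sumU-reindex : ∀ A B (e : El A ↔ El B) (g : El B → ℕ) → sumU A (g ∘ Inverse.to e) ≡ sumU B g
sumU-reindex A B e g = begin
  sumU A (g ∘ to)                       ≡⟨ sumU-cong A (sym ∘ sum-over-b) ⟩
  sumU A (λ a → sumU B (term a))        ≡⟨ sumU-comm A B term ⟩
  sumU B (λ b → sumU A λ a → term a b)  ≡⟨ sumU-cong B sum-over-a ⟩
  sumU B g                              ∎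
  where
  open Inverse e
  open ≡-Reasoning
  term : El A → El B → ℕ
  term a b = ind (does (decEq B (to a) b)) * g b

  sum-over-b : ∀ a → sumU B (term a) ≡ g (to a)
  sum-over-b a = trans
    (sumU-single B (to a) λ b b≢ → ind-no (decEq B (to a) b) (g b) (b≢ ∘ sym))
    (ind-yes (decEq B (to a) (to a)) (g (to a)) refl)

  sum-over-a : ∀ b → sumU A (λ a → term a b) ≡ g b
  sum-over-a b = trans
    (sumU-single A (from b) λ a a≢ → ind-no (decEq B (to a) b) (g b)
      λ to-a≡b → a≢ (trans (sym (strictlyInverseʳ a)) (cong from to-a≡b)))
    (ind-yes (decEq B (to (from b)) b) (g b) (strictlyInverseˡ b))

-- Isomorphisms and embeddings of matrices

HasEdge : ∀ {I J} → Mat I J → Set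
HasEdge M = ∃₂ λ i j → M i j ≡ true

record _≃_ {I J I′ J′ : Set} (M : Mat I J) (N : Mat I′ J′) : Set where
  field
    rows : I ↔ I′
    cols : J ↔ J′
    preserves : ∀ i j → M i j ≡ N (Inverse.to rows i) (Inverse.to cols j)

record _≲_ {I J I′ J′ : Set} (M : Mat I J) (N : Mat I′ J′) : Set where
  field
    rows : I ↣ I′
    cols : J ↣ J′
    preserves : ∀ i j → M i j ≡ N (Injection.to rows i) (Injection.to cols j)

≃-refl : ∀ {I J} (M : Mat I J) → M ≃ M
≃-refl M = record { rows = ↔-id _ ; cols = ↔-id _ ; preserves = λ _ _ → refl }

≃-trans : ∀ {I J I′ J′ I″ J″} {M : Mat I J} {N : Mat I′ J′} {K : Mat I″ J″} → M ≃ N → N ≃ K → M ≃ K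
≃-trans e e′ = record
  { rows = rows e′ ↔-∘ rows e
  ; cols = cols e′ ↔-∘ cols e
  ; preserves = λ i j → trans (preserves e i j) (preserves e′ _ _)
  }
  where open _≃_

⊗-comm : ∀ {I J K L} (M : Mat I J) (N : Mat K L) → (M ⊗ N) ≃ (N ⊗ M)
⊗-comm M N = record
  { rows = ×-comm _ _
  ; cols = ×-comm _ _
  ; preserves = λ (i , k) (j , l) → ∧-comm (M i j) (N k l)
  }

⊗-cong : ∀ {I J K L I′ J′ K′ L′} {M : Mat I J} {M′ : Mat I′ J′} {N : Mat K L} {N′ : Mat K′ L′} →
  M ≃ M′ → N ≃ N′ → (M ⊗ N) ≃ (M′ ⊗ N′)
⊗-cong e e′ = record
  { rows = rows e ×-↔ rows e′
  ; cols = cols e ×-↔ cols e′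
  ; preserves = λ (i , k) (j , l) → cong₂ _∧_ (preserves e i j) (preserves e′ k l)
  }
  where open _≃_

PET⇒≃ᵀ : ∀ {m n} {M : Mat (Fin m) (Fin n)} → PET M → M ≃ transpose M
PET⇒≃ᵀ (σ , τ , pet) = record { rows = τ ; cols = σ ; preserves = λ i j → sym (pet j i) }

-- If y were missed, punching y out of the range would inject Fin m into a smaller Fin.
injective⇒surjective : ∀ {m n} {f : Fin m → Fin n} → Injective _≡_ _≡_ f → n ≤ m →
  ∀ y → ∃ λ x → f x ≡ y
injective⇒surjective {m} {suc n} {f} f-inj n<m y with Fin.any? (λ x → f x Fin.≟ y)
... | yes hit = hit
... | no miss = contradiction (Fin.injective⇒≤ f′-inj) (<⇒≱ n<m)
  where
  y≢f : ∀ x → y ≢ f x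
  y≢f x y≡fx = miss (x , sym y≡fx)
  f′ : Fin m → Fin n
  f′ x = punchOut (y≢f x)
  f′-inj : Injective _≡_ _≡_ f′
  f′-inj {x} {x′} eq = f-inj (Fin.punchOut-injective (y≢f x) (y≢f x′) eq)

↣×↣⇒↔ : ∀ {m n} → Fin m ↣ Fin n → Fin n ↣ Fin m → Fin m ↔ Fin n
↣×↣⇒↔ f g = mk↔ₛ′ to (proj₁ ∘ onto) (proj₂ ∘ onto) (λ x → injective (proj₂ (onto (to x))))
  where
  open Injection f
  onto = injective⇒surjective injective (Fin.injective⇒≤ (Injection.injective g))

≲ᵀ⇒PET : ∀ {m n} {M : Mat (Fin m) (Fin n)} → M ≲ transpose M → PET M
≲ᵀ⇒PET e = ↣×↣⇒↔ cols rows , ↣×↣⇒↔ rows cols , λ j i → sym (preserves i j)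
  where open _≲_ e

-- Counting placements of patterns

vec-↔ : ∀ {A B : Set} {n} → A ↔ B → Vec A n ↔ Vec B n
vec-↔ e = mk↔ₛ′ (Vec.map to) (Vec.map from) (map-inverse strictlyInverseˡ) (map-inverse strictlyInverseʳ)
  where
  open Inverse e using (to; from; strictlyInverseˡ; strictlyInverseʳ)
  map-inverse : ∀ {A B : Set} {n} {f : A → B} {g : B → A} → (∀ x → f (g x) ≡ x) →
    (xs : Vec B n) → Vec.map f (Vec.map g xs) ≡ xs
  map-inverse {f = f} {g} fg xs =
    trans (sym (Vec.map-∘ f g xs)) (trans (Vec.map-cong fg xs) (Vec.map-id xs))

_≐_ : Bool → Bool → Bool
x ≐ true = x
x ≐ false = not x

≐-refl : ∀ x → T (x ≐ x)
≐-refl true = _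
≐-refl false = _

≐-sound : ∀ x c → T (x ≐ c) → x ≡ c
≐-sound true true _ = refl
≐-sound false false _ = refl

does⇒ : ∀ {P : Set} (p? : Dec P) → does p? ≡ true → P
does⇒ (yes p) _ = p

record Bigraph : Set where
  constructor bigraph
  field
    Left Right : U
    adj : Mat (El Left) (El Right)
open Bigraph

finBigraph : ∀ {m n} → Mat (Fin m) (Fin n) → Bigraph
finBigraph {m} {n} M = bigraph (fin m) (fin n) M

_⊗ᴮ_ : Bigraph → Bigraph → Bigraph
G ⊗ᴮ H = bigraph (Left G ⊠ Left H) (Right G ⊠ Right H) (adj G ⊗ adj H)

module Patterns (a b : ℕ) where

  data Atom : Set where
    sameˡ : Fin a → Fin a → Atom
    sameʳ : Fin b → Fin b → Atom
    adjacent : Fin a → Fin b → Atom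

  Placement : Bigraph → U
  Placement G = vec (Left G) a ⊠ vec (Right G) b

  holds : (G : Bigraph) → El (Placement G) → Atom → Bool
  holds G (xs , ys) (sameˡ i i′) = does (decEq (Left G) (lookup xs i) (lookup xs i′))
  holds G (xs , ys) (sameʳ j j′) = does (decEq (Right G) (lookup ys j) (lookup ys j′))
  holds G (xs , ys) (adjacent i j) = adj G (lookup xs i) (lookup ys j)

  Literal : Set
  Literal = Atom × Bool

  holdsLit : (G : Bigraph) → El (Placement G) → Literal → Bool
  holdsLit G h (α , c) = holds G h α ≐ c

  count : Bigraph → List Atom → List Literal → ℕ
  count G P Ls = sumU (Placement G) λ h → ind (all (holdsLit G h) Ls ∧ all (holds G h) P)

  zipPlacements : ∀ G H → El (Placement G ⊠ Placement H) ↔ El (Placement (G ⊗ᴮ H))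
  zipPlacements G H = mk↔ₛ′ zipP unzipP
    (λ (zs , ws) → cong₂ _,_ (zip∘unzip zs) (zip∘unzip ws)) unzipP∘zipP
    where
    zipP : El (Placement G ⊠ Placement H) → El (Placement (G ⊗ᴮ H))
    zipP ((xs , ys) , (xs′ , ys′)) = zip xs xs′ , zip ys ys′
    unzipP : El (Placement (G ⊗ᴮ H)) → El (Placement G ⊠ Placement H)
    unzipP (zs , ws) = (proj₁ (unzip zs) , proj₁ (unzip ws)) , (proj₂ (unzip zs) , proj₂ (unzip ws))
    unzipP∘zipP : ∀ gh → unzipP (zipP gh) ≡ gh
    unzipP∘zipP ((xs , ys) , (xs′ , ys′)) rewrite unzip∘zip xs xs′ | unzip∘zip ys ys′ = refl

  holds-⊗ : ∀ G H g h α →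
    holds (G ⊗ᴮ H) (Inverse.to (zipPlacements G H) (g , h)) α ≡ holds G g α ∧ holds H h α
  holds-⊗ G H (xs , ys) (xs′ , ys′) (sameˡ i i′)
    rewrite lookup-zip i xs xs′ | lookup-zip i′ xs xs′ = refl
  holds-⊗ G H (xs , ys) (xs′ , ys′) (sameʳ j j′)
    rewrite lookup-zip j ys ys′ | lookup-zip j′ ys ys′ = refl
  holds-⊗ G H (xs , ys) (xs′ , ys′) (adjacent i j)
    rewrite lookup-zip i xs xs′ | lookup-zip j ys ys′ = refl

  all-holds-⊗ : ∀ G H g h P →
    all (holds (G ⊗ᴮ H) (Inverse.to (zipPlacements G H) (g , h))) P ≡ all (holds G g) P ∧ all (holds H h) P
  all-holds-⊗ G H g h [] = refl
  all-holds-⊗ G H g h (α ∷ P) =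
    trans (cong₂ _∧_ (holds-⊗ G H g h α) (all-holds-⊗ G H g h P))
          (interchange (holds G g α) (holds H h α) _ _)

  count-⊗ : ∀ G H P → count (G ⊗ᴮ H) P [] ≡ count G P [] * count H P []
  count-⊗ G H P = begin
    count (G ⊗ᴮ H) P []
      ≡⟨ sumU-reindex (Placement G ⊠ Placement H) (Placement (G ⊗ᴮ H)) (zipPlacements G H) _ ⟨
    sumU (Placement G ⊠ Placement H) (λ (g , h) → ind (all (holds (G ⊗ᴮ H) (zipped g h)) P))
      ≡⟨ sumU-cong (Placement G ⊠ Placement H) (λ (g , h) →
           trans (cong ind (all-holds-⊗ G H g h P)) (ind-∧ (all (holds G g) P) _)) ⟩
    sumU (Placement G ⊠ Placement H) (λ (g , h) → ind (all (holds G g) P) * ind (all (holds H h) P))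
      ≡⟨ sumU-⊠-* (Placement G) (Placement H) _ _ ⟩
    count G P [] * count H P [] ∎
    where
    open ≡-Reasoning
    zipped = λ g h → Inverse.to (zipPlacements G H) (g , h)

  placement-↔ : ∀ {G H} → adj G ≃ adj H → El (Placement G) ↔ El (Placement H)
  placement-↔ e = vec-↔ (_≃_.rows e) ×-↔ vec-↔ (_≃_.cols e)

  holds-≃ : ∀ {G H} (e : adj G ≃ adj H) h α → holds H (Inverse.to (placement-↔ e) h) α ≡ holds G h α
  holds-≃ {G} {H} e (xs , ys) (sameˡ i i′)
    rewrite lookup-map i (Inverse.to (_≃_.rows e)) xs | lookup-map i′ (Inverse.to (_≃_.rows e)) xs =
      does-decEq-↔ (Left G) (Left H) (_≃_.rows e) _ _
  holds-≃ {G} {H} e (xs , ys) (sameʳ j j′)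
    rewrite lookup-map j (Inverse.to (_≃_.cols e)) ys | lookup-map j′ (Inverse.to (_≃_.cols e)) ys =
      does-decEq-↔ (Right G) (Right H) (_≃_.cols e) _ _
  holds-≃ {G} {H} e (xs , ys) (adjacent i j)
    rewrite lookup-map i (Inverse.to (_≃_.rows e)) xs | lookup-map j (Inverse.to (_≃_.cols e)) ys =
      sym (_≃_.preserves e (lookup xs i) (lookup ys j))

  count-≃ : ∀ {G H} → adj G ≃ adj H → ∀ P Ls → count G P Ls ≡ count H P Ls
  count-≃ {G} {H} e P Ls = trans
    (sumU-cong (Placement G) λ h → cong₂ (λ l p → ind (l ∧ p))
      (cong and (List.map-cong (λ (α , c) → cong (_≐ c) (sym (holds-≃ e h α))) Ls))
      (cong and (List.map-cong (sym ∘ holds-≃ e h) P)))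
    (sumU-reindex (Placement G) (Placement H) (placement-↔ e) _)

  count-literal-true : ∀ G P α Ls → count G P ((α , true) ∷ Ls) ≡ count G (α ∷ P) Ls
  count-literal-true G P α Ls = sumU-cong (Placement G) λ h →
    cong ind (reassociate (holds G h α) (all (holdsLit G h) Ls) (all (holds G h) P))
    where
    reassociate : ∀ e l p → (e ∧ l) ∧ p ≡ l ∧ (e ∧ p)
    reassociate true l p = refl
    reassociate false true p = refl
    reassociate false false p = refl

  count-literal-false : ∀ G P α Ls → count G P ((α , false) ∷ Ls) + count G (α ∷ P) Ls ≡ count G P Ls
  count-literal-false G P α Ls = trans (sym (sumU-+ (Placement G) _ _)) (sumU-cong (Placement G) λ h →
    split (holds G h α) (all (holdsLit G h) Ls) (all (holds G h) P))
    where
    split : ∀ e l p → ind ((not e ∧ l) ∧ p) + ind (l ∧ (e ∧ p)) ≡ ind (l ∧ p)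
    split true true _ = refl
    split true false _ = refl
    split false true true = refl
    split false true false = refl
    split false false _ = refl

  -- Inclusion–exclusion: a negated atom is a difference of two counts with fewer negations.
  count-literals : ∀ {G H} → (∀ P → count G P [] ≡ count H P []) → ∀ Ls P → count G P Ls ≡ count H P Ls
  count-literals agree [] P = agree P
  count-literals {G} {H} agree ((α , true) ∷ Ls) P = begin
    count G P ((α , true) ∷ Ls)  ≡⟨ count-literal-true G P α Ls ⟩
    count G (α ∷ P) Ls           ≡⟨ count-literals agree Ls (α ∷ P) ⟩
    count H (α ∷ P) Ls           ≡⟨ count-literal-true H P α Ls ⟨
    count H P ((α , true) ∷ Ls)  ∎
    where open ≡-Reasoning
  count-literals {G} {H} agree ((α , false) ∷ Ls) P = +-cancelʳ-≡ (count G (α ∷ P) Ls) _ _ (begin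
    count G P ((α , false) ∷ Ls) + count G (α ∷ P) Ls  ≡⟨ count-literal-false G P α Ls ⟩
    count G P Ls                                        ≡⟨ count-literals agree Ls P ⟩
    count H P Ls                                        ≡⟨ count-literal-false H P α Ls ⟨
    count H P ((α , false) ∷ Ls) + count H (α ∷ P) Ls  ≡⟨ cong (count H P ((α , false) ∷ Ls) +_) (count-literals agree Ls (α ∷ P)) ⟨
    count H P ((α , false) ∷ Ls) + count G (α ∷ P) Ls  ∎)
    where open ≡-Reasoning

  1≤count : ∀ G P Ls h → T (all (holds G h) P) → T (all (holdsLit G h) Ls) → 1 ≤ count G P Ls
  1≤count G P Ls h tP tLs =
    ≤-trans (≤-reflexive (sym (T⇒ind≡1 (Equivalence.from T-∧ (tLs , tP))))) (≤-sumU (Placement G) _ h)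

  count-pos : ∀ G → HasEdge (adj G) → ∀ P → 1 ≤ count G P []
  count-pos G (x₀ , y₀ , edge) P =
    1≤count G P [] constant (all⁻ (holds G constant) (All.universal holds-constant P)) _
    where
    constant : El (Placement G)
    constant = replicate a x₀ , replicate b y₀
    holds-constant : ∀ α → T (holds G constant α)
    holds-constant (sameˡ i i′) rewrite lookup-replicate i x₀ | lookup-replicate i′ x₀ =
      Equivalence.from T-≡ (dec-true (decEq (Left G) x₀ x₀) refl)
    holds-constant (sameʳ j j′) rewrite lookup-replicate j y₀ | lookup-replicate j′ y₀ =
      Equivalence.from T-≡ (dec-true (decEq (Right G) y₀ y₀) refl)
    holds-constant (adjacent i j) rewrite lookup-replicate i x₀ | lookup-replicate j y₀ =
      Equivalence.from T-≡ edge

  atomsOf : ∀ {m n} → (Fin m → Fin n → Atom) → List Atom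
  atomsOf {m} {n} f = cartesianProductWith f (List.allFin m) (List.allFin n)

  ∈-atomsOf : ∀ {m n} (f : Fin m → Fin n → Atom) i j → f i j ∈ atomsOf f
  ∈-atomsOf f i j = ∈-cartesianProductWith⁺ f (∈-allFin i) (∈-allFin j)

  allAtoms : List Atom
  allAtoms = atomsOf sameˡ ++ atomsOf sameʳ ++ atomsOf adjacent

  ∈-allAtoms : ∀ α → α ∈ allAtoms
  ∈-allAtoms (sameˡ i i′) = ∈-++⁺ˡ (∈-atomsOf sameˡ i i′)
  ∈-allAtoms (sameʳ j j′) = ∈-++⁺ʳ (atomsOf sameˡ) (∈-++⁺ˡ (∈-atomsOf sameʳ j j′))
  ∈-allAtoms (adjacent i j) = ∈-++⁺ʳ (atomsOf sameˡ) (∈-++⁺ʳ (atomsOf sameʳ) (∈-atomsOf adjacent i j))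

  -- The literals fixing every atom to its value at h₀ are satisfied by h₀, hence counted positively.
  realize-profile : ∀ {X G} → (∀ Ls → count X [] Ls ≡ count G [] Ls) →
    ∀ h₀ → ∃ λ h → ∀ α → holds G h α ≡ holds X h₀ α
  realize-profile {X} {G} agree h₀ = h , λ α → ≐-sound _ _ (All.lookup satisfied (∈-allAtoms α))
    where
    profile : List Literal
    profile = List.map (λ α → α , holds X h₀ α) allAtoms
    count-X≢0 : count X [] profile ≢ 0
    count-X≢0 = m<n⇒n≢0 (1≤count X [] profile h₀ _
      (all⁻ (holdsLit X h₀) (map⁺ (All.universal (≐-refl ∘ holds X h₀) allAtoms))))
    found = sumU-nonzero (Placement G) _ (count-X≢0 ∘ trans (agree profile))
    h = proj₁ found
    satisfied = map⁻ (all⁺ (holdsLit G h) profile (proj₁ (Equivalence.to T-∧ (ind≢0⇒T _ (proj₂ found)))))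

  profile⇒≲ : ∀ {G} {M : Mat (Fin a) (Fin b)} ((xs , ys) : El (Placement G)) →
    (∀ α → holds G (xs , ys) α ≡ holds (finBigraph M) (allFin a , allFin b) α) → M ≲ adj G
  profile⇒≲ {G} {M} (xs , ys) agree = record
    { rows = mk↣ λ {i} {i′} eq → allFin-injective (does⇒ (decEq (fin a) _ _)
        (trans (sym (agree (sameˡ i i′))) (dec-true (decEq (Left G) _ _) eq)))
    ; cols = mk↣ λ {j} {j′} eq → allFin-injective (does⇒ (decEq (fin b) _ _)
        (trans (sym (agree (sameʳ j j′))) (dec-true (decEq (Right G) _ _) eq)))
    ; preserves = λ i j → trans (sym (cong₂ M (lookup-allFin i) (lookup-allFin j))) (sym (agree (adjacent i j)))
    }
    where
    allFin-injective : ∀ {n} {i i′ : Fin n} → lookup (allFin n) i ≡ lookup (allFin n) i′ → i ≡ i′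
    allFin-injective {i = i} {i′} eq = trans (sym (lookup-allFin i)) (trans eq (lookup-allFin i′))

cancellation : ∀ {m n a b c d} {A : Mat (Fin m) (Fin n)} {M : Mat (Fin a) (Fin b)} {N : Mat (Fin c) (Fin d)} →
  HasEdge A → (A ⊗ M) ≃ (A ⊗ N) → M ≲ N
cancellation {a = a} {b} {A = A} {M} {N} edge A⊗M≃A⊗N =
  let h , agree = realize-profile (λ Ls → count-literals positive-agree Ls []) (allFin a , allFin b)
  in profile⇒≲ h agree
  where
  open Patterns a b
  positive-agree : ∀ P → count (finBigraph M) P [] ≡ count (finBigraph N) P []
  positive-agree P =
    *-cancelˡ-≡ _ _ (count (finBigraph A) P []) {{>-nonZero (count-pos (finBigraph A) edge P)}} (begin
    count (finBigraph A) P [] * count (finBigraph M) P []  ≡⟨ count-⊗ (finBigraph A) (finBigraph M) P ⟨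
    count (finBigraph A ⊗ᴮ finBigraph M) P []              ≡⟨ count-≃ A⊗M≃A⊗N P [] ⟩
    count (finBigraph A ⊗ᴮ finBigraph N) P []              ≡⟨ count-⊗ (finBigraph A) (finBigraph N) P ⟩
    count (finBigraph A) P [] * count (finBigraph N) P []  ∎)
    where open ≡-Reasoning

-- Bipartite double covers

hasEdge⊎PET : ∀ {m n} (V : Mat (Fin m) (Fin n)) → NoIsolated (toMat (bip V)) → HasEdge V ⊎ PET V
hasEdge⊎PET {suc m} V noIsolated with noIsolated (inj₁ zero)
... | inj₂ j , edge = inj₁ (zero , j , edge)
hasEdge⊎PET {zero} {zero} V _ = inj₂ (Perm.id , Perm.id , λ ())
hasEdge⊎PET {zero} {suc n} V noIsolated with noIsolated (inj₂ zero)
... | inj₁ () , _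

side-swap : ∀ {I J : Set} (x : I ⊎ J) → side (swap x) ≡ not (side x)
side-swap (inj₁ _) = refl
side-swap (inj₂ _) = refl

restrictˡ : ∀ {I J I′ J′ : Set} (f : (I ⊎ J) ↔ (I′ ⊎ J′)) → (∀ v → side (Inverse.to f v) ≡ side v) →
  Σ (I ↔ I′) λ ρ → ∀ i → Inverse.to f (inj₁ i) ≡ inj₁ (Inverse.to ρ i)
restrictˡ f same = mk↔ₛ′ ρ ρ⁻¹ ρ∘ρ⁻¹ ρ⁻¹∘ρ , λ i → proj₂ (left (same (inj₁ i)))
  where
  open Inverse f
  left : ∀ {A B : Set} {x : A ⊎ B} → side x ≡ true → ∃ λ a → x ≡ inj₁ a
  left {x = inj₁ a} _ = a , refl
  same⁻¹ : ∀ y → side (from y) ≡ side y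
  same⁻¹ y = trans (sym (same (from y))) (cong side (strictlyInverseˡ y))
  ρ = λ i → proj₁ (left (same (inj₁ i)))
  ρ⁻¹ = λ i′ → proj₁ (left (same⁻¹ (inj₁ i′)))
  ρ∘ρ⁻¹ : ∀ i′ → ρ (ρ⁻¹ i′) ≡ i′
  ρ∘ρ⁻¹ i′ = inj₁-injective (begin
    inj₁ (ρ (ρ⁻¹ i′))   ≡⟨ proj₂ (left (same (inj₁ (ρ⁻¹ i′)))) ⟨
    to (inj₁ (ρ⁻¹ i′))  ≡⟨ cong to (proj₂ (left (same⁻¹ (inj₁ i′)))) ⟨
    to (from (inj₁ i′)) ≡⟨ strictlyInverseˡ (inj₁ i′) ⟩
    inj₁ i′             ∎)
    where open ≡-Reasoning
  ρ⁻¹∘ρ : ∀ i → ρ⁻¹ (ρ i) ≡ i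
  ρ⁻¹∘ρ i = inj₁-injective (begin
    inj₁ (ρ⁻¹ (ρ i))    ≡⟨ proj₂ (left (same⁻¹ (inj₁ (ρ i)))) ⟨
    from (inj₁ (ρ i))   ≡⟨ cong from (proj₂ (left (same (inj₁ i)))) ⟨
    from (to (inj₁ i))  ≡⟨ strictlyInverseʳ (inj₁ i) ⟩
    inj₁ i              ∎)
    where open ≡-Reasoning

-- The right halves are handled by conjugating f with the swap of summands.
side-preserving⇒split : ∀ {I J I′ J′ : Set} (f : (I ⊎ J) ↔ (I′ ⊎ J′)) → (∀ v → side (Inverse.to f v) ≡ side v) →
  Σ (I ↔ I′) λ ρ → Σ (J ↔ J′) λ κ →
    (∀ i → Inverse.to f (inj₁ i) ≡ inj₁ (Inverse.to ρ i)) × (∀ j → Inverse.to f (inj₂ j) ≡ inj₂ (Inverse.to κ j))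
side-preserving⇒split {I} {J} {I′} {J′} f same =
  ρ , κ , f-inj₁ , λ j → trans (sym (swap-involutive (Inverse.to f (inj₂ j)))) (cong swap (f-inj₂ j))
  where
  swapped = ⊎-comm I′ J′ ↔-∘ (f ↔-∘ ⊎-comm J I)
  swapped-same : ∀ v → side (Inverse.to swapped v) ≡ side v
  swapped-same v = begin
    side (swap (Inverse.to f (swap v)))  ≡⟨ side-swap (Inverse.to f (swap v)) ⟩
    not (side (Inverse.to f (swap v)))   ≡⟨ cong not (same (swap v)) ⟩
    not (side (swap v))                  ≡⟨ cong not (side-swap v) ⟩
    not (not (side v))                   ≡⟨ not-involutive (side v) ⟩
    side v                               ∎
    where open ≡-Reasoning
  ρ = proj₁ (restrictˡ f same)
  f-inj₁ = proj₂ (restrictˡ f same)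
  κ = proj₁ (restrictˡ swapped swapped-same)
  f-inj₂ = proj₂ (restrictˡ swapped swapped-same)

respecting⇒≃ : ∀ {I J I′ J′} {M : Mat I J} {N : Mat I′ J′} →
  IsoRespecting (bip M) (bip N) → M ≃ N ⊎ M ≃ transpose N
respecting⇒≃ {N = N} (f , iso , inj₁ same) =
  let ρ , κ , f-inj₁ , f-inj₂ = side-preserving⇒split f same
  in inj₁ (record { rows = ρ ; cols = κ ; preserves = λ i j →
       trans (iso (inj₁ i) (inj₂ j)) (cong₂ (toMat (bip N)) (f-inj₁ i) (f-inj₂ j)) })
respecting⇒≃ {I′ = I′} {J′} {N = N} (f , iso , inj₂ flips) =
  let ρ , κ , f-inj₁ , f-inj₂ = side-preserving⇒split (⊎-comm I′ J′ ↔-∘ f) flipped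
  in inj₂ (record { rows = ρ ; cols = κ ; preserves = λ i j →
       trans (iso (inj₁ i) (inj₂ j)) (cong₂ (toMat (bip N)) (unswap (f-inj₁ i)) (unswap (f-inj₂ j))) })
  where
  flipped : ∀ v → side (swap (Inverse.to f v)) ≡ side v
  flipped v = trans (side-swap (Inverse.to f v)) (trans (cong not (flips v)) (not-involutive (side v)))
  unswap : ∀ {A B : Set} {x : A ⊎ B} {y} → swap x ≡ y → x ≡ swap y
  unswap {x = x} eq = trans (sym (swap-involutive x)) (cong swap eq)

≃⇒respecting : ∀ {I J I′ J′} {M : Mat I J} {N : Mat I′ J′} →
  M ≃ N ⊎ M ≃ transpose N → IsoRespecting (bip M) (bip N)
≃⇒respecting (inj₁ e) = (rows ⊎-↔ cols) , iso , inj₁ λ { (inj₁ _) → refl ; (inj₂ _) → refl }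
  where
  open _≃_ e
  iso : IsGraphIso (toMat (bip _)) (toMat (bip _)) (rows ⊎-↔ cols)
  iso (inj₁ _) (inj₁ _) = refl
  iso (inj₁ i) (inj₂ j) = preserves i j
  iso (inj₂ j) (inj₁ i) = preserves i j
  iso (inj₂ _) (inj₂ _) = refl
≃⇒respecting {I} {J} (inj₂ e) = ((cols ⊎-↔ rows) ↔-∘ ⊎-comm I J) , iso , inj₂ λ { (inj₁ _) → refl ; (inj₂ _) → refl }
  where
  open _≃_ e
  iso : IsGraphIso (toMat (bip _)) (toMat (bip _)) ((cols ⊎-↔ rows) ↔-∘ ⊎-comm I J)
  iso (inj₁ _) (inj₁ _) = refl
  iso (inj₁ i) (inj₂ j) = preserves i j
  iso (inj₂ j) (inj₁ i) = preserves i j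
  iso (inj₂ _) (inj₂ _) = refl

theorem4p1 : ∀ {m n p q : ℕ} (V : Mat (Fin m) (Fin n)) (B : Mat (Fin p) (Fin q)) →
    NoIsolated (toMat (bip V)) → NoIsolated (toMat (bip B)) →
    (IsoRespecting (bip V ⊗̲ bip B) (bip V ⊗̲ bipSharp B) → (PET V ⊎ PET B))
    × ((PET V ⊎ PET B) → IsoRespecting (bip V ⊗̲ bip B) (bip V ⊗̲ bipSharp B))
theorem4p1 V B noIsolatedV noIsolatedB = forward , backward
  where
  -- bip V ⊗̲ bip B and bip V ⊗̲ bipSharp B are definitionally bip (V ⊗ B) and bip (V ⊗ transpose B).
  forward : IsoRespecting (bip (V ⊗ B)) (bip (V ⊗ transpose B)) → PET V ⊎ PET B
  forward iso with respecting⇒≃ iso | hasEdge⊎PET V noIsolatedV | hasEdge⊎PET B noIsolatedB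
  ... | inj₁ _        | inj₂ petV  | _          = inj₁ petV
  ... | inj₁ V⊗B≃V⊗Bᵀ | inj₁ edgeV | _          = inj₂ (≲ᵀ⇒PET (cancellation edgeV V⊗B≃V⊗Bᵀ))
  ... | inj₂ _        | _          | inj₂ petB  = inj₂ petB
  ... | inj₂ V⊗B≃Vᵀ⊗B | _          | inj₁ edgeB = inj₁ (≲ᵀ⇒PET (cancellation edgeB
          (≃-trans (⊗-comm B V) (≃-trans V⊗B≃Vᵀ⊗B (⊗-comm (transpose V) B)))))
  backward : PET V ⊎ PET B → IsoRespecting (bip (V ⊗ B)) (bip (V ⊗ transpose B))
  backward (inj₁ petV) = ≃⇒respecting (inj₂ (⊗-cong (PET⇒≃ᵀ petV) (≃-refl B)))
  backward (inj₂ petB) = ≃⇒respecting (inj₁ (⊗-cong (≃-refl V) (PET⇒≃ᵀ petB)))
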